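{- Let $(C,\odot,s,t)$ be a catoid with a map $(-)^-:C\to C$ such that $s(x)\in x\odot x^-$ and $t(x)\in x^-\odot x$ for all $x\in C$. Then: (1) $C$ is local; (2) $s(x^-)=t(x)$ and $t(x^-)=s(x)$ for all $x$; (3) $x\odot y=\{s(x)\}$ implies $x^-=y$, and $y\odot x=\{t(x)\}$ implies $x^-=y$; (4) $s(x)^-=s(x)$ and $t(x)^-=t(x)$ for all $x$.
   Context: A catoid $(C,\odot,s,t)$ is a set with $\odot:C\times C\to\mathcal P C$ and $s,t:C\to C$ such that, with $X\odot Y=\bigcup_{x\in X,y\in Y}x\odot y$: $x\odot(y\odot z)=(x\odot y)\odot z$, $x\odot y\ne\emptyset\Rightarrow t(x)=s(y)$, $s(x)\odot x=\{x\}$, $x\odot t(x)=\{x\}$. It is local if $t(x)=s(y)\Rightarrow x\odot y\ne\emptyset$. -}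

module Defs where

open import Level using (Level; _⊔_; suc)
open import Data.Product using (Σ; ∃; ∃-syntax; _×_; _,_)
open import Relation.Binary.PropositionalEquality using (_≡_)
open import Relation.Nullary using (¬_)

-- Subsets of C are predicates  C → Set ℓ ; a multioperation ⊙ : C × C → 𝒫 C
-- is represented by its membership relation  Mul x y z  ⇔  z ∈ x ⊙ y.

_≐_ : ∀ {a ℓ ℓ'} {C : Set a} → (C → Set ℓ) → (C → Set ℓ') → Set (a ⊔ ℓ ⊔ ℓ')
P ≐ Q = ∀ z → (P z → Q z) × (Q z → P z)

｛_｝ : ∀ {a} {C : Set a} → C → C → Set a
｛ x ｝ z = z ≡ x

NonEmpty : ∀ {a ℓ} {C : Set a} → (C → Set ℓ) → Set (a ⊔ ℓ)
NonEmpty {C = C} P = ∃[ z ] P z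

record Catoid (a ℓ : Level) : Set (suc (a ⊔ ℓ)) where
  field
    Carrier : Set a
    Mul     : Carrier → Carrier → Carrier → Set ℓ
    s t     : Carrier → Carrier

  _⊙_ : Carrier → Carrier → Carrier → Set ℓ
  x ⊙ y = Mul x y

  ⊙-right : Carrier → Carrier → Carrier → Carrier → Set (a ⊔ ℓ)
  ⊙-right x y z u = ∃[ w ] (Mul y z w × Mul x w u)

  ⊙-left : Carrier → Carrier → Carrier → Carrier → Set (a ⊔ ℓ)
  ⊙-left x y z u = ∃[ w ] (Mul x y w × Mul w z u)

  field
    assoc   : ∀ x y z → ⊙-right x y z ≐ ⊙-left x y z
    defined : ∀ x y → NonEmpty (x ⊙ y) → t x ≡ s y
    s-unit  : ∀ x → (s x ⊙ x) ≐ ｛ x ｝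
    t-unit  : ∀ x → (x ⊙ t x) ≐ ｛ x ｝

  Local : Set (a ⊔ ℓ)
  Local = ∀ x y → t x ≡ s y → NonEmpty (x ⊙ y)

{-# OPTIONS --safe #-}
module Submission where

open import Defs
open import Level using (Level)
open import Data.Product using (_×_; _,_; proj₁; proj₂; ∃-syntax)
open import Function using (_∘_)
open import Relation.Binary.PropositionalEquality
  using (_≡_; _≗_; refl; sym; trans; subst)

-- If t x = s y then y ∈ s y ⊙ y ⊆ (x⁻ ⊙ x) ⊙ y = x⁻ ⊙ (x ⊙ y), so some w ∈ x ⊙ y
-- has y ∈ x⁻ ⊙ w: this gives locality, and if x ⊙ y = {s x} then w = s x = t x⁻,
-- so y ∈ x⁻ ⊙ t x⁻ = {x⁻}. Units are self-inverse because s x ⊙ s x = {s x}.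

module CatoidProperties {a ℓ : Level} (C : Catoid a ℓ) where
  open Catoid C

  x∈sx⊙x : ∀ x → Mul (s x) x x
  x∈sx⊙x x = proj₂ (s-unit x x) refl

  x∈x⊙tx : ∀ x → Mul x (t x) x
  x∈x⊙tx x = proj₂ (t-unit x x) refl

  t∘s≗s : t ∘ s ≗ s
  t∘s≗s x = defined (s x) x (x , x∈sx⊙x x)

  s∘t≗t : s ∘ t ≗ t
  s∘t≗t x = sym (defined x (t x) (x , x∈x⊙tx x))

  sx⊙sx≐｛sx｝ : ∀ x → (s x ⊙ s x) ≐ ｛ s x ｝
  sx⊙sx≐｛sx｝ x = subst (λ u → (s x ⊙ u) ≐ ｛ s x ｝) (t∘s≗s x) (t-unit (s x))

  tx⊙tx≐｛tx｝ : ∀ x → (t x ⊙ t x) ≐ ｛ t x ｝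
  tx⊙tx≐｛tx｝ x = subst (λ u → (u ⊙ t x) ≐ ｛ t x ｝) (s∘t≗t x) (s-unit (t x))

  y∈u⊙[x⊙y] : ∀ u x y → Mul u x (s y) → ∃[ w ] (Mul x y w × Mul u w y)
  y∈u⊙[x⊙y] u x y sy∈u⊙x = proj₂ (assoc u x y y) (s y , sy∈u⊙x , x∈sx⊙x y)

  y∈[y⊙x]⊙u : ∀ y x u → Mul x u (t y) → ∃[ w ] (Mul y x w × Mul w u y)
  y∈[y⊙x]⊙u y x u ty∈x⊙u = proj₁ (assoc y x u y) (t y , ty∈x⊙u , x∈x⊙tx y)

module Inversion {a ℓ : Level} (C : Catoid a ℓ)
                 (inv : Catoid.Carrier C → Catoid.Carrier C)
                 (sx∈x⊙inv-x : ∀ x → Catoid.Mul C x (inv x) (Catoid.s C x))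
                 (tx∈inv-x⊙x : ∀ x → Catoid.Mul C (inv x) x (Catoid.t C x)) where
  open Catoid C
  open CatoidProperties C

  s∘inv≗t : s ∘ inv ≗ t
  s∘inv≗t x = sym (defined x (inv x) (s x , sx∈x⊙inv-x x))

  t∘inv≗s : t ∘ inv ≗ s
  t∘inv≗s x = defined (inv x) x (t x , tx∈inv-x⊙x x)

  local : Local
  local x y tx≡sy
    with w , w∈x⊙y , _ ← y∈u⊙[x⊙y] (inv x) x y (subst (Mul (inv x) x) tx≡sy (tx∈inv-x⊙x x))
    = w , w∈x⊙y

  inv-uniqueʳ : ∀ x y → (x ⊙ y) ≐ ｛ s x ｝ → inv x ≡ y
  inv-uniqueʳ x y x⊙y≐｛sx｝ =
    conclude (y∈u⊙[x⊙y] (inv x) x y (subst (Mul (inv x) x) tx≡sy (tx∈inv-x⊙x x)))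
    where
    tx≡sy : t x ≡ s y
    tx≡sy = defined x y (s x , proj₂ (x⊙y≐｛sx｝ (s x)) refl)
    conclude : ∃[ w ] (Mul x y w × Mul (inv x) w y) → inv x ≡ y
    conclude (w , w∈x⊙y , y∈inv-x⊙w) =
      sym (proj₁ (t-unit (inv x) y) (subst (λ u → Mul (inv x) u y) w≡t-inv-x y∈inv-x⊙w))
      where
      w≡t-inv-x : w ≡ t (inv x)
      w≡t-inv-x = trans (proj₁ (x⊙y≐｛sx｝ w) w∈x⊙y) (sym (t∘inv≗s x))

  inv-uniqueˡ : ∀ x y → (y ⊙ x) ≐ ｛ t x ｝ → inv x ≡ y
  inv-uniqueˡ x y y⊙x≐｛tx｝ =
    conclude (y∈[y⊙x]⊙u y x (inv x) (subst (Mul x (inv x)) sx≡ty (sx∈x⊙inv-x x)))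
    where
    sx≡ty : s x ≡ t y
    sx≡ty = sym (defined y x (t x , proj₂ (y⊙x≐｛tx｝ (t x)) refl))
    conclude : ∃[ w ] (Mul y x w × Mul w (inv x) y) → inv x ≡ y
    conclude (w , w∈y⊙x , y∈w⊙inv-x) =
      sym (proj₁ (s-unit (inv x) y) (subst (λ u → Mul u (inv x) y) w≡s-inv-x y∈w⊙inv-x))
      where
      w≡s-inv-x : w ≡ s (inv x)
      w≡s-inv-x = trans (proj₁ (y⊙x≐｛tx｝ w) w∈y⊙x) (sym (s∘inv≗t x))

  inv∘s≗s : inv ∘ s ≗ s
  inv∘s≗s x = inv-uniqueˡ (s x) (s x)
    (subst (λ u → (s x ⊙ s x) ≐ ｛ u ｝) (sym (t∘s≗s x)) (sx⊙sx≐｛sx｝ x))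

  inv∘t≗t : inv ∘ t ≗ t
  inv∘t≗t x = inv-uniqueʳ (t x) (t x)
    (subst (λ u → (t x ⊙ t x) ≐ ｛ u ｝) (sym (s∘t≗t x)) (tx⊙tx≐｛tx｝ x))

lemma3p1 : ∀ {a ℓ} (C : Catoid a ℓ) → let open Catoid C in
    (inv : Carrier → Carrier) →
    (∀ x → Mul x (inv x) (s x)) →
    (∀ x → Mul (inv x) x (t x)) →
    Local
    × ((∀ x → s (inv x) ≡ t x) × (∀ x → t (inv x) ≡ s x))
    × ((∀ x y → (x ⊙ y) ≐ ｛ s x ｝ → inv x ≡ y)
       × (∀ x y → (y ⊙ x) ≐ ｛ t x ｝ → inv x ≡ y))
    × ((∀ x → inv (s x) ≡ s x) × (∀ x → inv (t x) ≡ t x))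
lemma3p1 C inv sx∈x⊙inv-x tx∈inv-x⊙x =
  local , (s∘inv≗t , t∘inv≗s) , (inv-uniqueʳ , inv-uniqueˡ) , (inv∘s≗s , inv∘t≗t)
  where open Inversion C inv sx∈x⊙inv-x tx∈inv-x⊙x
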